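{- Let $n\ge 4$ be an integer and $\gamma=\omega^4\cdot(n-2)+1$. Let $\mathfrak{c}_1:[\gamma]^2\to\{0,1\}$ be the coloring that assigns $1$ to exactly those pairs forced to be $1$ by at least one of the following eleven connections, and $0$ to all other pairs: downward connections of degree $4$ from rank $3$ to rank $1$; forward connections of degree $4$ from rank $2$ to rank $0$; backward connections of degree $4$ from rank $3$ to rank $0$; forward connections of degree $4$ from rank $3$ to rank $2$; downward connections of degree $3$ from rank $2$ to rank $1$; forward connections of degree $3$ from rank $2$ to rank $0$; backward connections of degree $3$ from rank $2$ to rank $0$; downward connections of degree $2$ from rank $1$ to rank $0$; forward connections of degree $5$ from rank $4$ to rank $0$; backward connections of degree $5$ from rank $4$ to rank $0$; downward connections of degree $5$ from rank $4$ to rank $3$. Then there is no three-element set $Y\subseteq\gamma$ with $\mathfrak{c}_1\equiv1$ on $[Y]^2$, and there is no set $X\subseteq\gamma$ which is a closed copy of $\omega\cdot n+1$ with $\mathfrak{c}_1\equiv 0$ on $[X]^2$.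
   Context: Cantor–Bendixson rank: for a nonzero ordinal $\gamma$ with Cantor normal form $\omega^{\alpha_1}k_1+\dots+\omega^{\alpha_m}k_m$ ($\alpha_1>\dots>\alpha_m$, $k_i\ge1$), $CB(\gamma)=\alpha_m$; and $CB(0)=0$. For ordinals, $\beta <^* \alpha$ means $\alpha=\beta+\omega^{\delta}$ for some $\delta>CB(\beta)$; $\beta\le^*\alpha$ means $\beta<^*\alpha$ or $\beta=\alpha$. For integers $0\le j<k$, a matryoshka box of degree $k$ and rank $j$ is a set of the form $\{\alpha<\omega^\omega: CB(\alpha)=j,\ \alpha\le^*\delta\}$ for some $\delta<\omega^\omega$ with $CB(\delta)=k-1$. Distinct boxes of the same degree are disjoint; for fixed $k,j$ the boxes of degree $k$ and rank $j$, ordered by $M\prec N$ iff $\sup M<\inf N$, form a well-order of type $\omega^\omega$, and $M_k(\theta,j)$ ($\theta<\omega^\omega$) denotes the $\theta$-th one (starting from $\theta=0$). For a coloring $\mathfrak{c}$ of pairs of an ordinal $\gamma<\omega^\omega$ and integers $0\le j_2<j_1<k$: $\mathfrak{c}$ has forward (resp. backward) connections of degree $k$ from rank $j_1$ to $j_2$ if $\mathfrak{c}(\{\alpha,\beta\})=1$ for all $\alpha\in M_k(\theta_1,j_1)\cap\gamma$, $\beta\in M_k(\theta_2,j_2)\cap\gamma$ whenever $\theta_1<\theta_2$ (resp. $\theta_1>\theta_2$) and $M_k(\theta_1,j_2)$, $M_k(\theta_2,j_2)$ are contained in the same matryoshka box of degree $k+1$; $\mathfrak{c}$ has downward connections of degree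 $k$ from rank $j_1$ to $j_2$ if $\mathfrak{c}(\{\alpha,\beta\})=1$ for all $\alpha\in M_k(\theta,j_1)\cap\gamma$, $\beta\in M_k(\theta,j_2)\cap\gamma$, for every $\theta$. Ordinals carry the order topology; $X\subseteq\gamma$ is a closed copy of $\beta$ if some map $X\to\beta$ is both an order-isomorphism and a homeomorphism (subspace topology on $X$). -}

module Defs where

open import Data.Nat using (ℕ; zero; suc; _+_; _∸_; _<_; _≡ᵇ_; _<ᵇ_)
open import Data.Bool using (if_then_else_)
open import Data.Vec using (Vec; []; _∷_; replicate; _++_)
open import Data.Maybe using (Maybe; just; nothing)
open import Data.Product using (Σ; _×_; _,_)
open import Data.Sum using (_⊎_)
open import Data.Unit using (⊤)
open import Relation.Binary.PropositionalEquality using (_≡_)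

-- Ordinals below ω^ω, in Cantor normal form (canonical, no side proofs).
--   zer          = 0
--   cnf d c v    = ω^d·(1+c) + ω^(d-1)·v[d-1] + … + ω^0·v[0]
-- (v[i] is the coefficient of ω^i, for i < d).

data Ord : Set where
  zer : Ord
  cnf : (d c : ℕ) → Vec ℕ d → Ord

coefV : ∀ {d} → Vec ℕ d → ℕ → ℕ
coefV []      i       = 0
coefV (x ∷ v) zero    = x
coefV (x ∷ v) (suc i) = coefV v i

coef : Ord → ℕ → ℕ
coef zer         e = 0
coef (cnf d c v) e = if e ≡ᵇ d then suc c else coefV v e

_<ₒ_ : Ord → Ord → Set
α <ₒ β = Σ ℕ λ e → (coef α e < coef β e) × (∀ e' → e < e' → coef α e' ≡ coef β e')

-- Cantor–Bendixson rank: the least exponent in the CNF; CB(0) = 0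
cbV : ∀ {d} → Vec ℕ d → ℕ
cbV []          = 0
cbV (zero ∷ v)  = suc (cbV v)
cbV (suc x ∷ v) = 0

cb : Ord → ℕ
cb zer         = 0
cb (cnf d c v) = cbV v

-- coefficients of the ordinal sum β + ω^e
plusPowCoef : Ord → ℕ → ℕ → ℕ
plusPowCoef β e i =
  if e <ᵇ i then coef β i else (if i ≡ᵇ e then suc (coef β e) else 0)

-- β <* α  iff  α = β + ω^e for some e > CB(β)
-- (e ranges over ℕ since α < ω^ω; equality of ordinals is equality of
-- all CNF coefficients)
_<*_ : Ord → Ord → Set
β <* α = Σ ℕ λ e → (cb β < e) × (∀ i → coef α i ≡ plusPowCoef β e i)

_≤*_ : Ord → Ord → Set
β ≤* α = (β <* α) ⊎ (β ≡ α)

-- membership in the set {α : CB(α) = j, α ≤* δ}; this is the matryoshka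
-- box of degree k and rank j when CB(δ) = k-1 and j < k.
InBox : ℕ → Ord → Ord → Set
InBox j δ α = (cb α ≡ j) × (α ≤* δ)

-- enum k θ = the θ-th ordinal δ < ω^ω with CB(δ) = k-1 (for k ≥ 2),
-- i.e. δ = ω^k·ξ + ω^(k-1)·(m+1) where θ = ω·ξ + m.
enum : ℕ → Ord → Ord
enum k zer                   = cnf (k ∸ 1) 0 (replicate (k ∸ 1) 0)
enum k (cnf zero c [])       = cnf (k ∸ 1) (suc c) (replicate (k ∸ 1) 0)
enum k (cnf (suc d) c (x ∷ v)) =
  cnf (k ∸ 1 + suc d) c (replicate (k ∸ 1) 0 ++ (suc x ∷ v))

M : ℕ → Ord → ℕ → Ord → Set
M k θ j α = InBox j (enum k θ) α

-- M_k(θ1,j) and M_k(θ2,j) are contained in the same matryoshka box of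
-- degree k+1
SameOuter : ℕ → ℕ → Ord → Ord → Set
SameOuter k j θ₁ θ₂ =
  Σ Ord λ δ → (cb δ ≡ k) × (Σ ℕ λ j' → (j' < suc k) ×
    ((∀ α → M k θ₁ j α → InBox j' δ α) × (∀ α → M k θ₂ j α → InBox j' δ α)))

-- the pair {α, β} (α of rank j₁, β of rank j₂) is forced to colour 1 by
-- forward / backward / downward connections of degree k from j₁ to j₂
Forward : ℕ → ℕ → ℕ → Ord → Ord → Set
Forward k j₁ j₂ α β = Σ Ord λ θ₁ → Σ Ord λ θ₂ →
  (θ₁ <ₒ θ₂) × SameOuter k j₂ θ₁ θ₂ × M k θ₁ j₁ α × M k θ₂ j₂ β

Backward : ℕ → ℕ → ℕ → Ord → Ord → Set
Backward k j₁ j₂ α β = Σ Ord λ θ₁ → Σ Ord λ θ₂ →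
  (θ₂ <ₒ θ₁) × SameOuter k j₂ θ₁ θ₂ × M k θ₁ j₁ α × M k θ₂ j₂ β

Downward : ℕ → ℕ → ℕ → Ord → Ord → Set
Downward k j₁ j₂ α β = Σ Ord λ θ → M k θ j₁ α × M k θ j₂ β

data Forced (α β : Ord) : Set where
  conn1  : Downward 4 3 1 α β → Forced α β
  conn2  : Forward  4 2 0 α β → Forced α β
  conn3  : Backward 4 3 0 α β → Forced α β
  conn4  : Forward  4 3 2 α β → Forced α β
  conn5  : Downward 3 2 1 α β → Forced α β
  conn6  : Forward  3 2 0 α β → Forced α β
  conn7  : Backward 3 2 0 α β → Forced α β
  conn8  : Downward 2 1 0 α β → Forced α β
  conn9  : Forward  5 4 0 α β → Forced α β
  conn10 : Backward 5 4 0 α β → Forced α β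
  conn11 : Downward 5 4 3 α β → Forced α β

-- 𝔠₁({α,β}) = 1 on [γ]²  (colour 0 is the negation)
Red : Ord → Ord → Ord → Set
Red γ α β = (α <ₒ γ) × (β <ₒ γ) × (Forced α β ⊎ Forced β α)

-- γ = ω^4·(n-2) + 1   (for n ≥ 4)
gammaOf : ℕ → Ord
gammaOf n = cnf 4 (n ∸ 3) (1 ∷ 0 ∷ 0 ∷ 0 ∷ [])

-- ω·n + 1   (for n ≥ 1)
omegaNPlus1 : ℕ → Ord
omegaNPlus1 n = cnf 1 (n ∸ 1) (1 ∷ [])

InInterval : Maybe Ord → Maybe Ord → Ord → Set
InInterval L R x = lo L × hi R
  where
  lo : Maybe Ord → Set
  lo nothing  = ⊤
  lo (just a) = a <ₒ x
  hi : Maybe Ord → Set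
  hi nothing  = ⊤
  hi (just b) = x <ₒ b

BelowOpt : Ord → Maybe Ord → Set
BelowOpt B nothing  = ⊤
BelowOpt B (just a) = a <ₒ B

-- U ∩ B is open in the order topology of the ordinal B
IsOpen : Ord → (Ord → Set) → Set
IsOpen B U = ∀ x → x <ₒ B → U x →
  Σ (Maybe Ord) λ L → Σ (Maybe Ord) λ R →
    BelowOpt B L × BelowOpt B R × InInterval L R x ×
    (∀ y → y <ₒ B → InInterval L R y → U y)

-- V ∩ X is open in the subspace topology on X ⊆ γ
IsOpenIn : Ord → (Ord → Set) → (Ord → Set) → Set₁
IsOpenIn γ X V = Σ (Ord → Set) λ U → IsOpen γ U ×
  (∀ x → X x → ((V x → U x) × (U x → V x)))

ClosedCopy : Ord → (Ord → Set) → Ord → Set₁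
ClosedCopy γ X β = (∀ x → X x → x <ₒ γ) × Σ (Ord → Ord) λ f →
  (∀ x → X x → f x <ₒ β) ×
  (∀ z → z <ₒ β → Σ Ord λ x → X x × (f x ≡ z)) ×
  (∀ x y → X x → X y → ((x <ₒ y → f x <ₒ f y) × (f x <ₒ f y → x <ₒ y))) ×
  (∀ U → IsOpen β U → IsOpenIn γ X (λ x → U (f x))) ×
  (∀ V → IsOpenIn γ X V → IsOpen β (λ z → Σ Ord λ x → X x × V x × (f x ≡ z)))

{-# OPTIONS --safe #-}
-- Everything is computed on Cantor normal form coefficients: coef α : ℕ → ℕ, compared
-- lexicographically from the top.  A point α of rank j ≤ m lies in the box M_(m+1)(θ, j)
-- exactly when α / ω^m has the coefficients of θ + 1 (if j = m) or of θ (if j < m).  Hence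
-- each of the eleven connections of degree m + 1 between p and q says that p and q agree
-- above ω^m and that their ω^m-coefficients satisfy one (in)equality.
--
-- Red triangles: the five rank patterns a triangle could have give incompatible
-- (in)equalities.
--
-- Closed copies: the limit points x₀ < … < x_(n−1) of a colour-0 closed copy of ω·n + 1 are
-- limits from below of points of X.  Just below a limit point y of rank r lie points a of X
-- that agree with y above ω^r and have a_r + 1 = y_r; avoiding red pairs with them forces
-- r ∈ {2, 3, 4}.  The weight x_4 + [rank x < 4] is then non-decreasing along the chain,
-- lies in 1 … n − 2, and stays constant on at most one step (from rank 2 to rank 4), which
-- leaves too few values for n points.

module Submission where

open import Defs
open import Data.Nat using (ℕ; zero; suc; _+_; _∸_; _≤_; _<_; _≡ᵇ_; _<ᵇ_; _⊓_; z≤n; s≤s; z<s; s<s)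
open import Data.Nat.Properties
open import Data.Bool using (true; if_then_else_)
open import Data.Vec using ([]; _∷_)
open import Data.Product using (Σ; _×_; _,_; proj₁; proj₂; map₁)
open import Data.Sum using (_⊎_; inj₁; inj₂)
open import Data.Empty using (⊥; ⊥-elim)
open import Data.Maybe using (just; nothing)
open import Data.Unit using (tt)
open import Function using (_∘_)
open import Relation.Nullary using (¬_; yes; no)
open import Relation.Binary using (Tri; tri<; tri≈; tri>)
open import Relation.Binary.PropositionalEquality

private
  variable
    F G H : ℕ → ℕ

-- Coefficient sequences

-- For F = coef α, down m F and up m F are the coefficients of α / ω^m and of ω^m · α.
down : ℕ → (ℕ → ℕ) → ℕ → ℕ
down m F i = F (m + i)

up : ℕ → (ℕ → ℕ) → ℕ → ℕ
up zero    F i       = F i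
up (suc m) F zero    = 0
up (suc m) F (suc i) = up m F i

setHead : ℕ → (ℕ → ℕ) → ℕ → ℕ
setHead c F zero    = c
setHead c F (suc i) = F (suc i)

incHead : (ℕ → ℕ) → ℕ → ℕ
incHead F = setHead (suc (F 0)) F

decHead : (ℕ → ℕ) → ℕ → ℕ
decHead F = setHead (F 0 ∸ 1) F

VanishBelow : ℕ → (ℕ → ℕ) → Set
VanishBelow m F = ∀ i → i < m → F i ≡ 0

record Finite (F : ℕ → ℕ) : Set where
  constructor finite
  field
    bound  : ℕ
    vanish : ∀ i → F (bound + i) ≡ 0

up-vanish : ∀ m F → VanishBelow m (up m F)
up-vanish (suc m) F zero    _         = refl
up-vanish (suc m) F (suc i) (s≤s i<m) = up-vanish m F i i<m

up-head : ∀ m F → up m F m ≡ F 0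
up-head zero    F = refl
up-head (suc m) F = up-head m F

down-up : ∀ m F → down m (up m F) ≗ F
down-up zero    F i = refl
down-up (suc m) F i = down-up m F i

up-down : ∀ m F → VanishBelow m F → up m (down m F) ≗ F
up-down zero    F _ i       = refl
up-down (suc m) F z zero    = sym (z 0 (s≤s z≤n))
up-down (suc m) F z (suc i) = up-down m (F ∘ suc) (λ k k<m → z (suc k) (s≤s k<m)) i

up-cong : ∀ m → F ≗ G → up m F ≗ up m G
up-cong zero    h i       = h i
up-cong (suc m) h zero    = refl
up-cong (suc m) h (suc i) = up-cong m h i

down-≗⇒ : ∀ m F G → down m F ≗ down m G → ∀ e → m ≤ e → F e ≡ G e
down-≗⇒ m F G h e m≤e = subst (λ k → F k ≡ G k) (m+[n∸m]≡n m≤e) (h (e ∸ m))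

down-head : ∀ m F → down m F ≗ G → F m ≡ G 0
down-head m F h = trans (cong F (sym (+-identityʳ m))) (h 0)

down-tail : ∀ m F → down m F ≗ G → down (suc m) F ≗ down 1 G
down-tail m F h i = trans (cong F (sym (+-suc m i))) (h (suc i))

down-cons : ∀ m F → F m ≡ G 0 → down (suc m) F ≗ down 1 G → down m F ≗ G
down-cons m F h₀ h₁ zero    = trans (cong F (+-identityʳ m)) h₀
down-cons m F h₀ h₁ (suc i) = trans (cong F (+-suc m i)) (h₁ i)

down-≗-cons : ∀ m F G → F m ≡ G m → down (suc m) F ≗ down (suc m) G → down m F ≗ down m G
down-≗-cons m F G h₀ h₁ zero    = subst (λ k → F k ≡ G k) (sym (+-identityʳ m)) h₀
down-≗-cons m F G h₀ h₁ (suc i) = subst (λ k → F k ≡ G k) (sym (+-suc m i)) (h₁ i)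

incHead-cong : F ≗ G → incHead F ≗ incHead G
incHead-cong h zero    = cong suc (h 0)
incHead-cong h (suc i) = h (suc i)

incHead-injective : incHead F ≗ incHead G → F ≗ G
incHead-injective h zero    = suc-injective (h 0)
incHead-injective h (suc i) = h (suc i)

incHead-decHead : F 0 ≢ 0 → incHead (decHead F) ≗ F
incHead-decHead {F} nz zero with F 0
... | zero  = ⊥-elim (nz refl)
... | suc c = refl
incHead-decHead nz (suc i) = refl

finite-≥ : (fin : Finite F) → ∀ e → Finite.bound fin ≤ e → F e ≡ 0
finite-≥ {F} (finite N z) = down-≗⇒ N F (λ _ → 0) z

finite-down : ∀ m → Finite F → Finite (down m F)
finite-down m fin@(finite N _) = finite N λ i → finite-≥ fin (m + (N + i)) (m≤n⇒m≤o+n m (m≤m+n N i))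

finite-up : ∀ m → Finite F → Finite (up m F)
finite-up {F} m (finite N z) = finite (m + N) λ i → trans (cong (up m F) (+-assoc m N i)) (trans (down-up m F (N + i)) (z i))

finite-setHead : ∀ c → Finite F → Finite (setHead c F)
finite-setHead {F} c (finite N z) = finite (suc N) λ i → trans (cong F (sym (+-suc N i))) (z (suc i))

-- Lexicographic order

-- α <ₒ β unfolds to Lex (coef α) (coef β).
Lex : (ℕ → ℕ) → (ℕ → ℕ) → Set
Lex F G = Σ ℕ λ e → (F e < G e) × (∀ e' → e < e' → F e' ≡ G e')

Lex-trans : Lex F G → Lex G H → Lex F H
Lex-trans {F} {G} {H} (e₁ , lt₁ , h₁) (e₂ , lt₂ , h₂) with <-cmp e₁ e₂
... | tri< e₁<e₂ _ _ = e₂ , subst (_< H e₂) (sym (h₁ e₂ e₁<e₂)) lt₂ ,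
                       λ e e₂<e → trans (h₁ e (<-trans e₁<e₂ e₂<e)) (h₂ e e₂<e)
... | tri≈ _ refl _  = e₁ , <-trans lt₁ lt₂ , λ e e₁<e → trans (h₁ e e₁<e) (h₂ e e₁<e)
... | tri> _ _ e₂<e₁ = e₁ , subst (F e₁ <_) (h₂ e₁ e₂<e₁) lt₁ ,
                       λ e e₁<e → trans (h₁ e e₁<e) (h₂ e (<-trans e₂<e₁ e₁<e))

Lex-irrefl : F ≗ G → ¬ Lex F G
Lex-irrefl h (e , lt , _) = <-irrefl (h e) lt

Lex-asym : Lex F G → ¬ Lex G F
Lex-asym FG GF = Lex-irrefl (λ _ → refl) (Lex-trans FG GF)

Lex-at : ∀ m → F m < G m → down (suc m) F ≗ down (suc m) G → Lex F G
Lex-at {F} {G} m lt h = m , lt , down-≗⇒ (suc m) F G h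

Lex-≤ : ∀ m → Lex F G → down (suc m) F ≗ down (suc m) G → F m ≤ G m
Lex-≤ {F} {G} m (e , lt , h) a with <-cmp e m
... | tri< e<m _ _ = ≤-reflexive (h m e<m)
... | tri≈ _ refl _ = <⇒≤ lt
... | tri> _ _ m<e  = ⊥-elim (<-irrefl (down-≗⇒ (suc m) F G a e m<e) lt)

Lex-< : ∀ m → Lex F G → down (suc m) F ≗ down (suc m) G → (∀ i → i < m → F i ≡ G i) → F m < G m
Lex-< {F} {G} m (e , lt , h) a b with <-cmp e m
... | tri< e<m _ _ = ⊥-elim (<-irrefl (b e e<m) lt)
... | tri≈ _ refl _ = lt
... | tri> _ _ m<e  = ⊥-elim (<-irrefl (down-≗⇒ (suc m) F G a e m<e) lt)

Lex-vanish : ∀ m → Lex F G → down m F ≗ down m G → VanishBelow m G → ⊥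
Lex-vanish {F} {G} m (e , lt , _) a z with e <? m
... | yes e<m = n≮0 (subst (F e <_) (z e e<m) lt)
... | no  e≮m = <-irrefl (down-≗⇒ m F G a e (≮⇒≥ e≮m)) lt

Lex-squeeze : ∀ m → Lex F G → Lex G H → down (suc m) F ≗ down (suc m) H → down (suc m) G ≗ down (suc m) H
Lex-squeeze {F} {G} {H} m FG (e , lt , h) a with m <? e
... | no  m≮e = λ i → h (suc m + i) (s≤s (≤-trans (≮⇒≥ m≮e) (m≤m+n m i)))
... | yes m<e = ⊥-elim (Lex-asym FG (e , subst (G e <_) (sym (down-≗⇒ (suc m) F H a e m<e)) lt ,
                  λ e' e<e' → trans (h e' e<e') (sym (down-≗⇒ (suc m) F H a e' (<-trans m<e e<e')))))

Lex-trichotomy : ∀ N → down N F ≗ down N G → Lex F G ⊎ F ≗ G ⊎ Lex G F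
Lex-trichotomy zero    h = inj₂ (inj₁ h)
Lex-trichotomy {F} {G} (suc N) h with <-cmp (F N) (G N)
... | tri< lt _ _ = inj₁ (Lex-at N lt h)
... | tri≈ _ eq _ = Lex-trichotomy N (down-≗-cons N F G eq h)
... | tri> _ _ gt = inj₂ (inj₂ (Lex-at N gt (sym ∘ h)))

Lex-finite : ∀ N → Lex F G → (∀ i → G (N + i) ≡ 0) → ∀ i → F (N + i) ≡ 0
Lex-finite {F} {G} N (e , lt , h) z i with e <? N
... | yes e<N = trans (h (N + i) (≤-trans e<N (m≤m+n N i))) (z i)
... | no  e≮N = ⊥-elim (n≮0 (subst (F e <_) (down-≗⇒ N G (λ _ → 0) z e (≮⇒≥ e≮N)) lt))

-- Ordinals from coefficients

_·ω+_ : Ord → ℕ → Ord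
zer       ·ω+ zero  = zer
zer       ·ω+ suc c = cnf 0 c []
cnf d c v ·ω+ x     = cnf (suc d) c (x ∷ v)

coef-·ω+ : ∀ α c → coef (α ·ω+ c) ≗ setHead c (up 1 (coef α))
coef-·ω+ zer         zero    zero    = refl
coef-·ω+ zer         zero    (suc i) = refl
coef-·ω+ zer         (suc c) zero    = refl
coef-·ω+ zer         (suc c) (suc i) = refl
coef-·ω+ (cnf d c v) x       zero    = refl
coef-·ω+ (cnf d c v) x       (suc i) = refl

tail : Ord → Ord
tail zer                     = zer
tail (cnf zero c [])         = zer
tail (cnf (suc d) c (x ∷ v)) = cnf d c v

tail-·ω+ : ∀ α → tail α ·ω+ coef α 0 ≡ α
tail-·ω+ zer                     = refl
tail-·ω+ (cnf zero c [])         = refl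
tail-·ω+ (cnf (suc d) c (x ∷ v)) = refl

coef-tail : ∀ α i → coef (tail α) i ≡ coef α (suc i)
coef-tail α i = trans (sym (coef-·ω+ (tail α) (coef α 0) (suc i))) (cong (λ β → coef β (suc i)) (tail-·ω+ α))

fromCoef : ℕ → (ℕ → ℕ) → Ord
fromCoef zero    F = zer
fromCoef (suc N) F = fromCoef N (F ∘ suc) ·ω+ F 0

coef-fromCoef : ∀ N F → (∀ i → F (N + i) ≡ 0) → coef (fromCoef N F) ≗ F
coef-fromCoef zero    F z i       = sym (z i)
coef-fromCoef (suc N) F z zero    = coef-·ω+ (fromCoef N (F ∘ suc)) (F 0) zero
coef-fromCoef (suc N) F z (suc i) =
  trans (coef-·ω+ (fromCoef N (F ∘ suc)) (F 0) (suc i)) (coef-fromCoef N (F ∘ suc) z i)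

fromCoef-cong : ∀ N → F ≗ G → fromCoef N F ≡ fromCoef N G
fromCoef-cong zero    h = refl
fromCoef-cong (suc N) h = cong₂ _·ω+_ (fromCoef-cong N (h ∘ suc)) (h 0)

ordOf : Finite F → Ord
ordOf {F} fin = fromCoef (Finite.bound fin) F

coef-ordOf : (fin : Finite F) → coef (ordOf fin) ≗ F
coef-ordOf {F} (finite N z) = coef-fromCoef N F z

coef-cnf-top≢0 : ∀ d c v → coef (cnf d c v) d ≢ 0
coef-cnf-top≢0 d c v with d ≡ᵇ d | ≡⇒≡ᵇ d d refl
... | true | _ = λ ()

coef≗0⇒zer : ∀ α → (∀ i → coef α i ≡ 0) → α ≡ zer
coef≗0⇒zer zer         _ = refl
coef≗0⇒zer (cnf d c v) z = ⊥-elim (coef-cnf-top≢0 d c v (z d))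

finite-cnf : ∀ d c v → Finite (coef (cnf d c v))
finite-cnf zero    c []      = finite 1 λ _ → refl
finite-cnf (suc d) c (x ∷ v) with finite-cnf d c v
... | finite N z = finite (suc N) z

finite-coef : ∀ α → Finite (coef α)
finite-coef zer         = finite 0 λ _ → refl
finite-coef (cnf d c v) = finite-cnf d c v

fromCoef-coef : ∀ N α → (∀ i → coef α (N + i) ≡ 0) → fromCoef N (coef α) ≡ α
fromCoef-coef zero    α z = sym (coef≗0⇒zer α z)
fromCoef-coef (suc N) α z = begin
  fromCoef N (coef α ∘ suc) ·ω+ coef α 0  ≡⟨ cong (_·ω+ coef α 0) (fromCoef-cong N (sym ∘ coef-tail α)) ⟩
  fromCoef N (coef (tail α)) ·ω+ coef α 0 ≡⟨ cong (_·ω+ coef α 0) (fromCoef-coef N (tail α) tail-vanishes) ⟩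
  tail α ·ω+ coef α 0                     ≡⟨ tail-·ω+ α ⟩
  α                                       ∎
  where
  open ≡-Reasoning
  tail-vanishes : ∀ i → coef (tail α) (N + i) ≡ 0
  tail-vanishes i = trans (coef-tail α (N + i)) (z i)

coef-ext : ∀ α β → coef α ≗ coef β → α ≡ β
coef-ext α β h = begin
  α                      ≡⟨ sym (fromCoef-coef N α (Finite.vanish fin)) ⟩
  fromCoef N (coef α)    ≡⟨ fromCoef-cong N h ⟩
  fromCoef N (coef β)    ≡⟨ fromCoef-coef N β (λ i → trans (sym (h (N + i))) (Finite.vanish fin i)) ⟩
  β                      ∎
  where
  open ≡-Reasoning
  fin = finite-coef α
  N = Finite.bound fin

-- Cantor–Bendixson rank and matryoshka boxes

coef-<cb-cnf : ∀ d c v → VanishBelow (cbV v) (coef (cnf d c v))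
coef-<cb-cnf (suc d) c (zero ∷ v) zero    _         = refl
coef-<cb-cnf (suc d) c (zero ∷ v) (suc i) (s≤s i<) = coef-<cb-cnf d c v i i<

coef-<cb : ∀ α → VanishBelow (cb α) (coef α)
coef-<cb (cnf d c v) = coef-<cb-cnf d c v

coef-cb≢0-cnf : ∀ d c v → coef (cnf d c v) (cbV v) ≢ 0
coef-cb≢0-cnf zero    c []          = λ ()
coef-cb≢0-cnf (suc d) c (suc x ∷ v) = λ ()
coef-cb≢0-cnf (suc d) c (zero ∷ v)  = coef-cb≢0-cnf d c v

coef-cb≢0 : ∀ α → α ≢ zer → coef α (cb α) ≢ 0
coef-cb≢0 zer         α≢0 = ⊥-elim (α≢0 refl)
coef-cb≢0 (cnf d c v) _   = coef-cb≢0-cnf d c v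

cb-up : ∀ α m F → coef α ≗ up m F → F 0 ≢ 0 → cb α ≡ m
cb-up α m F h nz with <-cmp (cb α) m
... | tri< lt _ _ = ⊥-elim (coef-cb≢0 α (λ { refl → nz (trans (sym (up-head m F)) (sym (h m))) })
                            (trans (h (cb α)) (up-vanish m F (cb α) lt)))
... | tri≈ _ eq _ = eq
... | tri> _ _ gt = ⊥-elim (nz (trans (sym (up-head m F)) (trans (sym (h m)) (coef-<cb α m gt))))

cb>0⇒≢zer : ∀ {α} → 0 < cb α → α ≢ zer
cb>0⇒≢zer 0<cb refl = n≮0 0<cb

enum-suc : ∀ m θ → enum (suc (suc m)) θ ≡ enum (suc m) θ ·ω+ 0
enum-suc m zer                     = refl
enum-suc m (cnf zero c [])         = refl
enum-suc m (cnf (suc d) c (x ∷ v)) = refl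

coef-enum-1 : ∀ θ → coef (enum 1 θ) ≗ incHead (coef θ)
coef-enum-1 zer                     zero    = refl
coef-enum-1 zer                     (suc i) = refl
coef-enum-1 (cnf zero c [])         zero    = refl
coef-enum-1 (cnf zero c [])         (suc i) = refl
coef-enum-1 (cnf (suc d) c (x ∷ v)) zero    = refl
coef-enum-1 (cnf (suc d) c (x ∷ v)) (suc i) = refl

coef-enum : ∀ m θ → coef (enum (suc m) θ) ≗ up m (incHead (coef θ))
coef-enum zero    θ i       = coef-enum-1 θ i
coef-enum (suc m) θ i rewrite enum-suc m θ = trans (coef-·ω+ (enum (suc m) θ) 0 i) (shift i)
  where
  shift : setHead 0 (up 1 (coef (enum (suc m) θ))) ≗ up (suc m) (incHead (coef θ))
  shift zero    = refl
  shift (suc k) = coef-enum m θ k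

cb-enum : ∀ m θ → cb (enum (suc m) θ) ≡ m
cb-enum m θ = cb-up (enum (suc m) θ) m (incHead (coef θ)) (coef-enum m θ) (λ ())

-- The terms of β below ω^e are absorbed by ω^e.
plusPowCoef-up : ∀ β e → plusPowCoef β e ≗ up e (incHead (down e (coef β)))
plusPowCoef-up β = go (coef β)
  where
  go : ∀ F e i → (if e <ᵇ i then F i else (if i ≡ᵇ e then suc (F e) else 0)) ≡ up e (incHead (down e F)) i
  go F zero    zero    = refl
  go F zero    (suc i) = refl
  go F (suc e) zero    = refl
  go F (suc e) (suc i) = go (F ∘ suc) e i

<*⇒ : ∀ {β α} → β <* α → cb β < cb α × coef α ≗ up (cb α) (incHead (down (cb α) (coef β)))
<*⇒ {β} {α} (e , cbβ<e , α≗) =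
  subst (λ r → cb β < r × coef α ≗ up r (incHead (down r (coef β)))) (sym cbα≡e) (cbβ<e , α≗up)
  where
  α≗up : coef α ≗ up e (incHead (down e (coef β)))
  α≗up i = trans (α≗ i) (plusPowCoef-up β e i)
  cbα≡e : cb α ≡ e
  cbα≡e = cb-up α e _ α≗up (λ ())

InBox-below : ∀ {j δ α r} → cb δ ≡ r → cb α < r → InBox j δ α → coef δ ≗ up r (incHead (down r (coef α)))
InBox-below {δ = δ} {α} refl lt (_ , inj₁ α<*δ) = proj₂ (<*⇒ {α} {δ} α<*δ)
InBox-below refl lt (_ , inj₂ refl) = ⊥-elim (<-irrefl refl lt)

M-top⇒ : ∀ {m θ α} → M (suc m) θ m α → down m (coef α) ≗ incHead (coef θ)
M-top⇒ {m} {θ} (_   , inj₂ refl)  i = trans (coef-enum m θ (m + i)) (down-up m _ i)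
M-top⇒ {m} {θ} {α} (cbα , inj₁ α<*δ) =
  ⊥-elim (<-irrefl (trans cbα (sym (cb-enum m θ))) (proj₁ (<*⇒ {α} {enum (suc m) θ} α<*δ)))

M-low⇒ : ∀ {j m θ α} → j < m → M (suc m) θ j α → down m (coef α) ≗ coef θ
M-low⇒ {j} {m} {θ} {α} j<m mem@(cbα , _) = incHead-injective λ i → begin
  incHead (down m (coef α)) i              ≡⟨ sym (down-up m _ i) ⟩
  up m (incHead (down m (coef α))) (m + i) ≡⟨ sym (InBox-below (cb-enum m θ) (subst (_< m) (sym cbα) j<m) mem (m + i)) ⟩
  coef (enum (suc m) θ) (m + i)            ≡⟨ coef-enum m θ (m + i) ⟩
  up m (incHead (coef θ)) (m + i)          ≡⟨ down-up m _ i ⟩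
  incHead (coef θ) i                       ∎
  where open ≡-Reasoning

⇒M-top : ∀ {m θ α} → cb α ≡ m → down m (coef α) ≗ incHead (coef θ) → M (suc m) θ m α
⇒M-top {m} {θ} {α} cbα h = cbα , inj₂ (coef-ext α (enum (suc m) θ) λ i → begin
  coef α i                   ≡⟨ sym (up-down m (coef α) (subst (λ r → VanishBelow r (coef α)) cbα (coef-<cb α)) i) ⟩
  up m (down m (coef α)) i   ≡⟨ up-cong m h i ⟩
  up m (incHead (coef θ)) i  ≡⟨ sym (coef-enum m θ i) ⟩
  coef (enum (suc m) θ) i    ∎)
  where open ≡-Reasoning

⇒M-low : ∀ {j m θ α} → cb α ≡ j → j < m → down m (coef α) ≗ coef θ → M (suc m) θ j α
⇒M-low {j} {m} {θ} {α} cbα j<m h = cbα , inj₁ (m , subst (_< m) (sym cbα) j<m , λ i →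
  trans (coef-enum m θ i) (trans (up-cong m (incHead-cong (sym ∘ h)) i) (sym (plusPowCoef-up α m i))))

M-inhabited : ∀ {j m} → j < m → ∀ θ → Σ Ord (M (suc m) θ j)
M-inhabited {j} {m} j<m θ = w , ⇒M-low cb-w j<m down-w
  where
  open ≡-Reasoning
  -- w = ω^m · θ + ω^j
  k = m ∸ suc j
  S = setHead 1 (up (suc k) (coef θ))
  fin = finite-up j (finite-setHead 1 (finite-up (suc k) (finite-coef θ)))
  w = ordOf fin
  cb-w : cb w ≡ j
  cb-w = cb-up w j S (coef-ordOf fin) (λ ())
  down-w : down m (coef w) ≗ coef θ
  down-w i = begin
    coef w (m + i)            ≡⟨ coef-ordOf fin (m + i) ⟩
    up j S (m + i)            ≡⟨ cong (λ t → up j S (t + i)) (sym (trans (+-suc j k) (m+[n∸m]≡n j<m))) ⟩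
    up j S (j + suc k + i)    ≡⟨ cong (up j S) (+-assoc j (suc k) i) ⟩
    up j S (j + (suc k + i))  ≡⟨ down-up j S (suc k + i) ⟩
    S (suc k + i)             ≡⟨ down-up (suc k) (coef θ) i ⟩
    coef θ i                  ∎

M-outer : ∀ {j m θ θ' α} → j < m → coef θ' ≗ down 1 (coef θ) → M (suc m) θ j α → M (suc (suc m)) θ' j α
M-outer {j} {m} {α = α} j<m θ'≗ mem@(cbα , _) =
  ⇒M-low cbα (m<n⇒m<1+n j<m) λ i → trans (down-tail m (coef α) (M-low⇒ j<m mem) i) (sym (θ'≗ i))

⇒SameOuter : ∀ {j m θ₁ θ₂} → j < m → down 1 (coef θ₁) ≗ down 1 (coef θ₂) → SameOuter (suc m) j θ₁ θ₂
⇒SameOuter {j} {m} {θ₁} j<m h =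
  enum (suc (suc m)) θ' , cb-enum (suc m) θ' , j , m<n⇒m<1+n (m<n⇒m<1+n j<m) ,
  (λ α → M-outer j<m (coef-ordOf fin)) , (λ α → M-outer j<m (λ i → trans (coef-ordOf fin i) (h i)))
  where
  fin = finite-down 1 (finite-coef θ₁)
  θ' = ordOf fin

SameOuter⇒ : ∀ {j m θ₁ θ₂} → j < m → SameOuter (suc m) j θ₁ θ₂ → down 1 (coef θ₁) ≗ down 1 (coef θ₂)
SameOuter⇒ {j} {m} {θ₁} {θ₂} j<m (δ , cbδ , j' , _ , in₁ , in₂)
  with M-inhabited j<m θ₁ | M-inhabited j<m θ₂
... | w₁ , w₁∈ | w₂ , w₂∈ = λ i → begin
  coef θ₁ (suc i)               ≡⟨ sym (down-tail m (coef w₁) (M-low⇒ j<m w₁∈) i) ⟩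
  down (suc m) (coef w₁) i      ≡⟨ incHead-injective same i ⟩
  down (suc m) (coef w₂) i      ≡⟨ down-tail m (coef w₂) (M-low⇒ j<m w₂∈) i ⟩
  coef θ₂ (suc i)               ∎
  where
  open ≡-Reasoning
  below : ∀ {θ w} → M (suc m) θ j w → cb w < suc m
  below (cbw , _) = subst (_< suc m) (sym cbw) (m<n⇒m<1+n j<m)
  same : incHead (down (suc m) (coef w₁)) ≗ incHead (down (suc m) (coef w₂))
  same k = begin
    incHead (down (suc m) (coef w₁)) k                    ≡⟨ sym (down-up (suc m) _ k) ⟩
    up (suc m) (incHead (down (suc m) (coef w₁))) (suc m + k) ≡⟨ sym (InBox-below cbδ (below w₁∈) (in₁ w₁ w₁∈) _) ⟩
    coef δ (suc m + k)                                     ≡⟨ InBox-below cbδ (below w₂∈) (in₂ w₂ w₂∈) _ ⟩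
    up (suc m) (incHead (down (suc m) (coef w₂))) (suc m + k) ≡⟨ down-up (suc m) _ k ⟩
    incHead (down (suc m) (coef w₂)) k                    ∎

-- Connections

lowBox : ∀ m q → Σ Ord λ θ → down m (coef q) ≗ coef θ
lowBox m q = ordOf fin , sym ∘ coef-ordOf fin
  where fin = finite-down m (finite-coef q)

topBox : ∀ m p → coef p m ≢ 0 → Σ Ord λ θ → down m (coef p) ≗ incHead (coef θ)
topBox m p nz = ordOf fin , λ i → trans (sym (incHead-decHead nz′ i)) (incHead-cong (sym ∘ coef-ordOf fin) i)
  where
  fin = finite-setHead _ (finite-down m (finite-coef p))
  nz′ : down m (coef p) 0 ≢ 0
  nz′ = nz ∘ trans (cong (coef p) (sym (+-identityʳ m)))

rank-coef≢0 : ∀ p {m j} → cb p ≡ m → j < m → coef p m ≢ 0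
rank-coef≢0 p refl j<m = coef-cb≢0 p (cb>0⇒≢zer (≤-<-trans z≤n j<m))

AgreeAbove : ℕ → Ord → Ord → Set
AgreeAbove m α β = down (suc m) (coef α) ≗ down (suc m) (coef β)

agree-cons : ∀ m x y → coef x (suc m) ≡ coef y (suc m) → AgreeAbove (suc m) x y → AgreeAbove m x y
agree-cons m x y = down-≗-cons (suc m) (coef x) (coef y)

<ₒ-head : ∀ x y {r} → x <ₒ y → cb x ≡ r → cb y ≡ r → AgreeAbove r x y → coef x r < coef y r
<ₒ-head x y x<y refl cby a = Lex-< (cb x) x<y a λ i i<r →
  trans (coef-<cb x i i<r) (sym (coef-<cb y i (subst (i <_) (sym cby) i<r)))

module _ {m : ℕ} (p q : Ord) where

  agree-through : ∀ F G → down m (coef p) ≗ F → down m (coef q) ≗ G → down 1 F ≗ down 1 G → AgreeAbove m p q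
  agree-through F G hp hq h i = trans (down-tail m (coef p) hp i) (trans (h i) (sym (down-tail m (coef q) hq i)))

  tails-through : ∀ F G → down m (coef p) ≗ F → down m (coef q) ≗ G → AgreeAbove m p q → down 1 F ≗ down 1 G
  tails-through F G hp hq a i = trans (sym (down-tail m (coef p) hp i)) (trans (a i) (down-tail m (coef q) hq i))

  downward⇒ : ∀ {j} → j < m → Downward (suc m) m j p q → coef p m ≡ suc (coef q m) × AgreeAbove m p q
  downward⇒ j<m (θ , p∈ , q∈) =
    trans (down-head m (coef p) hp) (cong suc (sym (down-head m (coef q) hq))) , agree-through _ _ hp hq (λ _ → refl)
    where
    hp = M-top⇒ p∈
    hq = M-low⇒ j<m q∈

  forwardTop⇒ : ∀ {j} → j < m → Forward (suc m) m j p q → coef p m ≤ coef q m × AgreeAbove m p q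
  forwardTop⇒ j<m (θ₁ , θ₂ , θ₁<θ₂ , same , p∈ , q∈) =
    subst₂ _≤_ (sym (down-head m (coef p) hp)) (sym (down-head m (coef q) hq)) (Lex-< 0 θ₁<θ₂ tails (λ _ ())) ,
    agree-through _ _ hp hq tails
    where
    hp = M-top⇒ p∈
    hq = M-low⇒ j<m q∈
    tails = SameOuter⇒ j<m same

  backwardTop⇒ : ∀ {j} → j < m → Backward (suc m) m j p q → suc (coef q m) < coef p m × AgreeAbove m p q
  backwardTop⇒ j<m (θ₁ , θ₂ , θ₂<θ₁ , same , p∈ , q∈) =
    subst₂ _<_ (cong suc (sym (down-head m (coef q) hq))) (sym (down-head m (coef p) hp))
      (s≤s (Lex-< 0 θ₂<θ₁ (sym ∘ tails) (λ _ ()))) ,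
    agree-through _ _ hp hq tails
    where
    hp = M-top⇒ p∈
    hq = M-low⇒ j<m q∈
    tails = SameOuter⇒ j<m same

  forwardLow⇒ : ∀ {i j} → i < m → j < m → Forward (suc m) i j p q → coef p m < coef q m × AgreeAbove m p q
  forwardLow⇒ i<m j<m (θ₁ , θ₂ , θ₁<θ₂ , same , p∈ , q∈) =
    subst₂ _<_ (sym (down-head m (coef p) hp)) (sym (down-head m (coef q) hq)) (Lex-< 0 θ₁<θ₂ tails (λ _ ())) ,
    agree-through _ _ hp hq tails
    where
    hp = M-low⇒ i<m p∈
    hq = M-low⇒ j<m q∈
    tails = SameOuter⇒ j<m same

  ⇒downward : ∀ {j} → cb p ≡ m → cb q ≡ j → j < m → coef p m ≡ suc (coef q m) → AgreeAbove m p q →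
    Downward (suc m) m j p q
  ⇒downward cbp cbq j<m top agree with lowBox m q
  ... | θ , hq = θ , ⇒M-top cbp hp , ⇒M-low cbq j<m hq
    where
    hp : down m (coef p) ≗ incHead (coef θ)
    hp = down-cons m (coef p) (trans top (cong suc (down-head m (coef q) hq))) (λ i → trans (agree i) (down-tail m (coef q) hq i))

  ⇒forwardTop : ∀ {j} → cb p ≡ m → cb q ≡ j → j < m → coef p m ≤ coef q m → AgreeAbove m p q →
    Forward (suc m) m j p q
  ⇒forwardTop cbp cbq j<m le agree with topBox m p (rank-coef≢0 p cbp j<m) | lowBox m q
  ... | θ₁ , hp | θ₂ , hq = θ₁ , θ₂ , Lex-at 0 head tails , ⇒SameOuter j<m tails , ⇒M-top cbp hp , ⇒M-low cbq j<m hq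
    where
    tails : down 1 (coef θ₁) ≗ down 1 (coef θ₂)
    tails = tails-through _ _ hp hq agree
    head : coef θ₁ 0 < coef θ₂ 0
    head = subst₂ _≤_ (down-head m (coef p) hp) (down-head m (coef q) hq) le

  ⇒backwardTop : ∀ {j} → cb p ≡ m → cb q ≡ j → j < m → suc (coef q m) < coef p m → AgreeAbove m p q →
    Backward (suc m) m j p q
  ⇒backwardTop cbp cbq j<m lt agree with topBox m p (rank-coef≢0 p cbp j<m) | lowBox m q
  ... | θ₁ , hp | θ₂ , hq = θ₁ , θ₂ , Lex-at 0 head (sym ∘ tails) , ⇒SameOuter j<m tails , ⇒M-top cbp hp , ⇒M-low cbq j<m hq
    where
    tails : down 1 (coef θ₁) ≗ down 1 (coef θ₂)
    tails = tails-through _ _ hp hq agree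
    head : coef θ₂ 0 < coef θ₁ 0
    head = ≤-pred (subst₂ _<_ (cong suc (down-head m (coef q) hq)) (down-head m (coef p) hp) lt)

  ⇒forwardLow : ∀ {i j} → cb p ≡ i → cb q ≡ j → i < m → j < m → coef p m < coef q m → AgreeAbove m p q →
    Forward (suc m) i j p q
  ⇒forwardLow cbp cbq i<m j<m lt agree with lowBox m p | lowBox m q
  ... | θ₁ , hp | θ₂ , hq = θ₁ , θ₂ , Lex-at 0 head tails , ⇒SameOuter j<m tails , ⇒M-low cbp i<m hp , ⇒M-low cbq j<m hq
    where
    tails : down 1 (coef θ₁) ≗ down 1 (coef θ₂)
    tails = tails-through _ _ hp hq agree
    head : coef θ₁ 0 < coef θ₂ 0
    head = subst₂ _<_ (down-head m (coef p) hp) (down-head m (coef q) hq) lt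

-- No red triangle

-- What a connection from p of rank i to q of rank j says about their coefficients.  At the top
-- level, forward and backward connections only matter through p_m ≢ q_m + 1.
data Link : ℕ → ℕ → Ord → Ord → Set where
  link10     : ∀ {p q} → coef p 1 ≡ suc (coef q 1) × AgreeAbove 1 p q → Link 1 0 p q
  link21     : ∀ {p q} → coef p 2 ≡ suc (coef q 2) × AgreeAbove 2 p q → Link 2 1 p q
  link20-low : ∀ {p q} → coef p 3 < coef q 3 × AgreeAbove 3 p q → Link 2 0 p q
  link20-top : ∀ {p q} → coef p 2 ≢ suc (coef q 2) × AgreeAbove 2 p q → Link 2 0 p q
  link31     : ∀ {p q} → coef p 3 ≡ suc (coef q 3) × AgreeAbove 3 p q → Link 3 1 p q
  link30     : ∀ {p q} → suc (coef q 3) < coef p 3 × AgreeAbove 3 p q → Link 3 0 p q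
  link32     : ∀ {p q} → coef p 3 ≤ coef q 3 × AgreeAbove 3 p q → Link 3 2 p q
  link40     : ∀ {p q} → coef p 4 ≢ suc (coef q 4) × AgreeAbove 4 p q → Link 4 0 p q
  link43     : ∀ {p q} → coef p 4 ≡ suc (coef q 4) × AgreeAbove 4 p q → Link 4 3 p q

link-rank< : ∀ {i j p q} → Link i j p q → j < i
link-rank< (link10     _) = z<s
link-rank< (link21     _) = s<s z<s
link-rank< (link20-low _) = z<s
link-rank< (link20-top _) = z<s
link-rank< (link31     _) = s<s z<s
link-rank< (link30     _) = z<s
link-rank< (link32     _) = s<s (s<s z<s)
link-rank< (link40     _) = z<s
link-rank< (link43     _) = s<s (s<s (s<s z<s))

at-ranks : ∀ {i j p q k k′ θ θ′} → M k θ i p → M k′ θ′ j q → Link i j p q → Link (cb p) (cb q) p q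
at-ranks (refl , _) (refl , _) l = l

≤⇒≢suc : ∀ {a b} → a ≤ b → a ≢ suc b
≤⇒≢suc a≤b refl = 1+n≰n a≤b

suc<⇒≢suc : ∀ {a b} → suc b < a → a ≢ suc b
suc<⇒≢suc b<a refl = <-irrefl refl b<a

forced⇒link : ∀ {p q} → Forced p q → Link (cb p) (cb q) p q
forced⇒link {p} {q} (conn1  d@(_ , p∈ , q∈))         = at-ranks p∈ q∈ (link31 (downward⇒ p q (s<s z<s) d))
forced⇒link {p} {q} (conn2  d@(_ , _ , _ , _ , p∈ , q∈)) = at-ranks p∈ q∈ (link20-low (forwardLow⇒ p q (s<s (s<s z<s)) z<s d))
forced⇒link {p} {q} (conn3  d@(_ , _ , _ , _ , p∈ , q∈)) = at-ranks p∈ q∈ (link30 (backwardTop⇒ p q z<s d))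
forced⇒link {p} {q} (conn4  d@(_ , _ , _ , _ , p∈ , q∈)) = at-ranks p∈ q∈ (link32 (forwardTop⇒ p q (s<s (s<s z<s)) d))
forced⇒link {p} {q} (conn5  d@(_ , p∈ , q∈))         = at-ranks p∈ q∈ (link21 (downward⇒ p q (s<s z<s) d))
forced⇒link {p} {q} (conn6  d@(_ , _ , _ , _ , p∈ , q∈)) = at-ranks p∈ q∈ (link20-top (map₁ ≤⇒≢suc (forwardTop⇒ p q z<s d)))
forced⇒link {p} {q} (conn7  d@(_ , _ , _ , _ , p∈ , q∈)) = at-ranks p∈ q∈ (link20-top (map₁ suc<⇒≢suc (backwardTop⇒ p q z<s d)))
forced⇒link {p} {q} (conn8  d@(_ , p∈ , q∈))         = at-ranks p∈ q∈ (link10 (downward⇒ p q z<s d))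
forced⇒link {p} {q} (conn9  d@(_ , _ , _ , _ , p∈ , q∈)) = at-ranks p∈ q∈ (link40 (map₁ ≤⇒≢suc (forwardTop⇒ p q z<s d)))
forced⇒link {p} {q} (conn10 d@(_ , _ , _ , _ , p∈ , q∈)) = at-ranks p∈ q∈ (link40 (map₁ suc<⇒≢suc (backwardTop⇒ p q z<s d)))
forced⇒link {p} {q} (conn11 d@(_ , p∈ , q∈))         = at-ranks p∈ q∈ (link43 (downward⇒ p q (s<s (s<s (s<s z<s))) d))

link-triangle : ∀ {i j k p q r} → Link i j p q → Link i k p r → Link j k q r → ⊥
link-triangle (link21 (pq₂ , pq)) (link20-low (pr₃ , _)) (link10 (_ , qr)) = <-irrefl (trans (pq 0) (qr 1)) pr₃
link-triangle (link21 (pq₂ , pq)) (link20-top (pr₂ , _)) (link10 (_ , qr)) = pr₂ (trans pq₂ (cong suc (qr 0)))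
link-triangle (link31 (pq₃ , _))  (link30 (rp₃ , _))     (link10 (_ , qr)) = <-irrefl (sym (trans pq₃ (cong suc (qr 1)))) rp₃
link-triangle (link32 (pq₃ , _))  (link31 (pr₃ , _))     (link21 (_ , qr)) = 1+n≰n (subst₂ _≤_ pr₃ (qr 0) pq₃)
link-triangle (link32 (pq₃ , _))  (link30 (rp₃ , _))     (link20-low (qr₃ , _)) =
  <-irrefl refl (<-trans (n<1+n _) (<-≤-trans rp₃ (<⇒≤ (≤-<-trans pq₃ qr₃))))
link-triangle (link32 (pq₃ , _))  (link30 (rp₃ , _))     (link20-top (_ , qr)) =
  <-irrefl refl (<-trans (n<1+n _) (<-≤-trans rp₃ (≤-trans pq₃ (≤-reflexive (qr 0)))))
link-triangle (link43 (pq₄ , _))  (link40 (pr₄ , _))     (link30 (_ , qr)) = pr₄ (trans pq₄ (cong suc (qr 0)))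

Linked : Ord → Ord → Set
Linked p q = Link (cb p) (cb q) p q ⊎ Link (cb q) (cb p) q p

no-linked-triangle : ∀ {a b c} → Linked a b → Linked a c → Linked b c → ⊥
no-linked-triangle (inj₁ ab) (inj₁ ac) (inj₁ bc) = link-triangle ab ac bc
no-linked-triangle (inj₁ ab) (inj₁ ac) (inj₂ cb) = link-triangle ac ab cb
no-linked-triangle (inj₁ ab) (inj₂ ca) (inj₁ bc) = <-asym (link-rank< ca) (<-trans (link-rank< bc) (link-rank< ab))
no-linked-triangle (inj₁ ab) (inj₂ ca) (inj₂ cb) = link-triangle ca cb ab
no-linked-triangle (inj₂ ba) (inj₁ ac) (inj₁ bc) = link-triangle ba bc ac
no-linked-triangle (inj₂ ba) (inj₁ ac) (inj₂ cb) = <-asym (link-rank< cb) (<-trans (link-rank< ac) (link-rank< ba))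
no-linked-triangle (inj₂ ba) (inj₂ ca) (inj₁ bc) = link-triangle bc ba ca
no-linked-triangle (inj₂ ba) (inj₂ ca) (inj₂ cb) = link-triangle cb ca ba

red⇒linked : ∀ {γ p q} → Red γ p q → Linked p q
red⇒linked (_ , _ , inj₁ pq) = inj₁ (forced⇒link pq)
red⇒linked (_ , _ , inj₂ qp) = inj₂ (forced⇒link qp)

no-red-triangle : ∀ γ → ¬ (Σ Ord λ a → Σ Ord λ b → Σ Ord λ c →
  (a <ₒ b) × (b <ₒ c) × (c <ₒ γ) × Red γ a b × Red γ a c × Red γ b c)
no-red-triangle γ (_ , _ , _ , _ , _ , _ , ab , ac , bc) =
  no-linked-triangle (red⇒linked {γ} ab) (red⇒linked {γ} ac) (red⇒linked {γ} bc)

-- Approach from below in a closed copy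

succ : Ord → Ord
succ l = ordOf (finite-setHead (suc (coef l 0)) (finite-coef l))

coef-succ : ∀ l → coef (succ l) ≗ incHead (coef l)
coef-succ l = coef-ordOf (finite-setHead (suc (coef l 0)) (finite-coef l))

<ₒ-succ : ∀ l → l <ₒ succ l
<ₒ-succ l = Lex-at 0 (subst (coef l 0 <_) (sym (coef-succ l 0)) (n<1+n _)) (λ i → sym (coef-succ l (suc i)))

succ-<ₒ : ∀ l w → l <ₒ w → coef w 0 ≡ 0 → succ l <ₒ w
succ-<ₒ l w (zero  , lt , _) w₀ = ⊥-elim (n≮0 (subst (_ <_) w₀ lt))
succ-<ₒ l w (suc e , lt , h) _ = suc e , subst (_< coef w (suc e)) (sym (coef-succ l (suc e))) lt , above
  where
  above : ∀ e' → suc e < e' → coef (succ l) e' ≡ coef w e'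
  above (suc e') e<e' = trans (coef-succ l (suc e')) (h (suc e') e<e')

¬<ₒzer : ∀ α → ¬ α <ₒ zer
¬<ₒzer α (_ , lt , _) = n≮0 lt

step-into-interval : ∀ y L R → InInterval L R y → zer <ₒ y → coef y 0 ≡ 0 → Σ Ord λ z → z <ₒ y × InInterval L R z
step-into-interval y nothing  nothing  _           0<y y₀ = succ zer , succ-<ₒ zer y 0<y y₀ , tt , tt
step-into-interval y nothing  (just r) (_ , y<r)   0<y y₀ =
  succ zer , succ-<ₒ zer y 0<y y₀ , tt , Lex-trans (succ-<ₒ zer y 0<y y₀) y<r
step-into-interval y (just l) nothing  (l<y , _)   _   y₀ = succ l , succ-<ₒ l y l<y y₀ , <ₒ-succ l , tt
step-into-interval y (just l) (just r) (l<y , y<r) _   y₀ =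
  succ l , succ-<ₒ l y l<y y₀ , <ₒ-succ l , Lex-trans (succ-<ₒ l y l<y y₀) y<r

ray-open : ∀ {γ} {X : Ord → Set} L → IsOpenIn γ X (L <ₒ_)
ray-open L = (L <ₒ_) , (λ y y<γ L<y → just L , nothing , Lex-trans L<y y<γ , tt , (L<y , tt) , λ _ _ → proj₁) ,
             λ _ _ → (λ h → h) , (λ h → h)

module _ {γ β : Ord} {X : Ord → Set} {f : Ord → Ord}
  (f<β : ∀ x → X x → f x <ₒ β)
  (f-reflects : ∀ x y → X x → X y → f x <ₒ f y → x <ₒ y)
  (f-open : ∀ V → IsOpenIn γ X V → IsOpen β (λ z → Σ Ord λ x → X x × V x × (f x ≡ z))) where

  approached-from-below : ∀ {x} → X x → zer <ₒ f x → coef (f x) 0 ≡ 0 →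
    ∀ L → L <ₒ x → Σ Ord λ a → X a × L <ₒ a × a <ₒ x
  approached-from-below {x} Xx 0<fx fx₀ L L<x
    with f-open (L <ₒ_) (ray-open L) (f x) (f<β x Xx) (x , Xx , L<x , refl)
  ... | L′ , R′ , _ , _ , fx∈ , inside with step-into-interval (f x) L′ R′ fx∈ 0<fx fx₀
  ...   | z , z<fx , z∈ with inside z (Lex-trans z<fx (f<β x Xx)) z∈
  ...     | a , Xa , L<a , refl = a , Xa , L<a , f-reflects a x Xa Xx z<fx

-- Limit points of a colour-0 set

growth-with-one-flat-step : (b : ℕ → ℕ) (N : ℕ) → (∀ i → i < N → b i ≤ b (suc i)) →
  (∀ i j → i < j → j < N → b i ≡ b (suc i) → b j ≡ b (suc j) → ⊥) → b 0 + N ≤ suc (b N)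
growth-with-one-flat-step b N mono unique = conclude (count N ≤-refl)
  where
  Flat : ℕ → Set
  Flat k = Σ ℕ λ i → i < k × b i ≡ b (suc i)
  Count : ℕ → Set
  Count k = (b 0 + k ≤ b k) ⊎ (Flat k × b 0 + k ≤ suc (b k))
  count : ∀ k → k ≤ N → Count k
  count zero    _   = inj₁ (≤-reflexive (+-identityʳ (b 0)))
  count (suc k) k<N with count k (<⇒≤ k<N) | m≤n⇒m<n∨m≡n (mono k k<N)
  ... | inj₁ le             | inj₁ lt = inj₁ (subst (_≤ b (suc k)) (sym (+-suc (b 0) k)) (≤-trans (s≤s le) lt))
  ... | inj₁ le             | inj₂ eq = inj₂ ((k , n<1+n k , eq) , subst₂ _≤_ (sym (+-suc (b 0) k)) (cong suc eq) (s≤s le))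
  ... | inj₂ ((i , i<k , flat) , le) | inj₁ lt =
        inj₂ ((i , <-trans i<k (n<1+n k) , flat) , subst (_≤ suc (b (suc k))) (sym (+-suc (b 0) k)) (≤-trans (s≤s le) (s≤s lt)))
  ... | inj₂ ((i , i<k , flat) , _) | inj₂ eq = ⊥-elim (unique i k i<k k<N flat eq)
  conclude : Count N → b 0 + N ≤ suc (b N)
  conclude (inj₁ le)       = m≤n⇒m≤1+n le
  conclude (inj₂ (_ , le)) = le

module Colour0 (n : ℕ) (X : Ord → Set)
  (X<γ : ∀ x → X x → x <ₒ gammaOf n)
  (colour0 : ∀ x y → X x → X y → x <ₒ y → ¬ Red (gammaOf n) x y) where

  vanish5 : ∀ {x} → X x → ∀ i → coef x (5 + i) ≡ 0
  vanish5 {x} Xx = Lex-finite 5 (X<γ x Xx) (λ _ → refl)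

  agree4 : ∀ {x y} → X x → X y → AgreeAbove 4 x y
  agree4 Xx Xy i = trans (vanish5 Xx i) (sym (vanish5 Xy i))

  no-forced : ∀ {p q} → X p → X q → cb p ≢ cb q → Forced p q → ⊥
  no-forced {p} {q} Xp Xq ranks pq with Lex-trichotomy 5 (agree4 Xp Xq)
  ... | inj₁ p<q        = colour0 p q Xp Xq p<q (X<γ p Xp , X<γ q Xq , inj₁ pq)
  ... | inj₂ (inj₁ p≗q) = ranks (cong cb (coef-ext p q p≗q))
  ... | inj₂ (inj₂ q<p) = colour0 q p Xq Xp q<p (X<γ q Xq , X<γ p Xp , inj₂ pq)

  module _ {p q : Ord} (Xp : X p) (Xq : X q) where

    private
      ranks≢ : ∀ {i j} → cb p ≡ i → cb q ≡ j → j < i → cb p ≢ cb q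
      ranks≢ cbp cbq j<i eq = <-irrefl (trans (sym cbq) (trans (sym eq) cbp)) j<i

    downward-excluded : ∀ {m j} → cb p ≡ m → cb q ≡ j → j < m → coef p m ≡ suc (coef q m) → AgreeAbove m p q →
      (Downward (suc m) m j p q → Forced p q) → ⊥
    downward-excluded cbp cbq j<m head agree conn =
      no-forced Xp Xq (ranks≢ cbp cbq j<m) (conn (⇒downward p q cbp cbq j<m head agree))

    forwardTop-excluded : ∀ {m j} → cb p ≡ m → cb q ≡ j → j < m → coef p m ≤ coef q m → AgreeAbove m p q →
      (Forward (suc m) m j p q → Forced p q) → ⊥
    forwardTop-excluded cbp cbq j<m head agree conn =
      no-forced Xp Xq (ranks≢ cbp cbq j<m) (conn (⇒forwardTop p q cbp cbq j<m head agree))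

    backwardTop-excluded : ∀ {m j} → cb p ≡ m → cb q ≡ j → j < m → suc (coef q m) < coef p m → AgreeAbove m p q →
      (Backward (suc m) m j p q → Forced p q) → ⊥
    backwardTop-excluded cbp cbq j<m head agree conn =
      no-forced Xp Xq (ranks≢ cbp cbq j<m) (conn (⇒backwardTop p q cbp cbq j<m head agree))

    forwardLow-excluded : ∀ {m i j} → cb p ≡ i → cb q ≡ j → j < i → i < m → coef p m < coef q m → AgreeAbove m p q →
      (Forward (suc m) i j p q → Forced p q) → ⊥
    forwardLow-excluded cbp cbq j<i i<m head agree conn =
      no-forced Xp Xq (ranks≢ cbp cbq j<i) (conn (⇒forwardLow p q cbp cbq i<m (<-trans j<i i<m) head agree))

  record LimitPoint (x : Ord) : Set where
    field
      limit∈X    : X x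
      nonzero    : x ≢ zer
      approached : ∀ L → L <ₒ x → Σ Ord λ a → X a × L <ₒ a × a <ₒ x

  record Approximant (y : Ord) (r : ℕ) (L : Ord) : Set where
    field
      point     : Ord
      point∈X   : X point
      above     : L <ₒ point
      agree     : AgreeAbove r point y
      pred-head : suc (coef point r) ≡ coef y r
      rank<     : cb point < r

  open LimitPoint
  open Approximant

  approach : ∀ {y r L} → LimitPoint y → cb y ≡ r → AgreeAbove r L y → suc (coef L r) ≡ coef y r →
    Approximant y r L
  approach {y} {r} {L} ly refl L≈y L-head with approached ly L (Lex-at r (≤-reflexive L-head) L≈y)
  ... | a , Xa , L<a , a<y = record
    { point = a ; point∈X = Xa ; above = L<a ; agree = a≈y ; pred-head = head ; rank< = rank }
    where
    a≈y : AgreeAbove r a y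
    a≈y = Lex-squeeze r L<a a<y L≈y
    L≈a : AgreeAbove r L a
    L≈a i = trans (L≈y i) (sym (a≈y i))
    a<y-head : coef a r < coef y r
    a<y-head = ≤∧≢⇒< (Lex-≤ r a<y a≈y)
      (λ eq → Lex-vanish r a<y (down-≗-cons r (coef a) (coef y) eq a≈y) (coef-<cb y))
    head : suc (coef a r) ≡ coef y r
    head = ≤-antisym a<y-head (subst (_≤ suc (coef a r)) L-head (s≤s (Lex-≤ r L<a L≈a)))
    rank : cb a < r
    rank with cb a <? r
    ... | yes lt = lt
    ... | no  r≤ = ⊥-elim (Lex-vanish r L<a
            (down-≗-cons r (coef L) (coef a) (suc-injective (trans L-head (sym head))) L≈a)
            (λ i i<r → coef-<cb a i (<-≤-trans i<r (≮⇒≥ r≤))))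

  some-approximant : ∀ {y r} → LimitPoint y → cb y ≡ r → Σ Ord (Approximant y r)
  some-approximant {y} ly refl = L , approach ly refl L≈y L-head
    where
    r = cb y
    -- L is y with its ω^r-coefficient lowered by one and its lower coefficients cleared.
    fin = finite-up r (finite-setHead _ (finite-down r (finite-coef y)))
    L = ordOf fin
    down-L : down r (coef L) ≗ decHead (down r (coef y))
    down-L i = trans (coef-ordOf fin (r + i)) (down-up r _ i)
    y-head : coef y r ≡ down r (coef y) 0
    y-head = down-head r (coef y) (λ _ → refl)
    L≈y : AgreeAbove r L y
    L≈y i = trans (down-tail r (coef L) down-L i) (sym (down-tail r (coef y) (λ _ → refl) i))
    L-head : suc (coef L r) ≡ coef y r
    L-head = trans (cong suc (down-head r (coef L) down-L))
      (trans (incHead-decHead {down r (coef y)} (coef-cb≢0 y (nonzero ly) ∘ trans y-head) 0) (sym y-head))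

  top≢0 : ∀ {x r} → LimitPoint x → cb x ≡ r → coef x r ≢ 0
  top≢0 {x} lx refl = coef-cb≢0 x (nonzero lx)

  approximant-not-downward : ∀ {y r L j} → LimitPoint y → cb y ≡ r → (a : Approximant y r L) → cb (point a) ≡ j →
    (Downward (suc r) r j y (point a) → Forced y (point a)) → ⊥
  approximant-not-downward ly cby a cba =
    downward-excluded (limit∈X ly) (point∈X a) cby cba (subst (_< _) cba (rank< a)) (sym (pred-head a)) (sym ∘ agree a)

  approximant-rank-2 : ∀ {y L} → LimitPoint y → cb y ≡ 2 → (a : Approximant y 2 L) → cb (point a) ≡ 0
  approximant-rank-2 ly cby a with cb (point a) in cba | rank< a
  ... | 0 | _ = refl
  ... | 1 | _ = ⊥-elim (approximant-not-downward ly cby a cba conn5)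
  ... | suc (suc _) | s<s (s<s ())

  approximant-rank-3 : ∀ {y L} → LimitPoint y → cb y ≡ 3 → (a : Approximant y 3 L) → cb (point a) ≡ 0 ⊎ cb (point a) ≡ 2
  approximant-rank-3 ly cby a with cb (point a) in cba | rank< a
  ... | 0 | _ = inj₁ refl
  ... | 1 | _ = ⊥-elim (approximant-not-downward ly cby a cba conn1)
  ... | 2 | _ = inj₂ refl
  ... | suc (suc (suc _)) | s<s (s<s (s<s ()))

  Low : Ord → Set
  Low x = cb x ≡ 2 ⊎ cb x ≡ 3

  rank-of-limit : ∀ {x} → LimitPoint x → Low x ⊎ cb x ≡ 4
  rank-of-limit {x} lx with cb x in cbx
  ... | 0 = ⊥-elim (n≮0 (rank< (proj₂ (some-approximant lx cbx))))
  ... | 1 = ⊥-elim (approximant-not-downward lx cbx a (n<1⇒n≡0 (rank< a)) conn8)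
    where a = proj₂ (some-approximant lx cbx)
  ... | 2 = inj₁ (inj₁ refl)
  ... | 3 = inj₁ (inj₂ refl)
  ... | 4 = inj₂ refl
  ... | suc (suc (suc (suc (suc k)))) = ⊥-elim (top≢0 lx cbx (vanish5 (limit∈X lx) k))

  agree3 : ∀ {x y} → X x → X y → coef x 4 ≡ coef y 4 → AgreeAbove 3 x y
  agree3 {x} {y} Xx Xy e₄ = agree-cons 3 x y e₄ (agree4 Xx Xy)

  coef4-≤ : ∀ {x y} → X x → X y → x <ₒ y → coef x 4 ≤ coef y 4
  coef4-≤ Xx Xy x<y = Lex-≤ 4 x<y (agree4 Xx Xy)

  coef4-< : ∀ {x y} → X x → X y → x <ₒ y → cb y ≡ 4 → coef x 4 < coef y 4
  coef4-< {x} {y} Xx Xy x<y cby = ≤∧≢⇒< (coef4-≤ Xx Xy x<y)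
    (λ e₄ → Lex-vanish 4 x<y (agree-cons 3 x y e₄ (agree4 Xx Xy)) (subst (λ r → VanishBelow r (coef y)) cby (coef-<cb y)))

  same-column-22 : ∀ {x y} → LimitPoint x → LimitPoint y → x <ₒ y → cb x ≡ 2 → cb y ≡ 2 → coef x 4 ≡ coef y 4 → ⊥
  same-column-22 {x} {y} lx ly x<y cbx cby e₄ = by-coef3 (m≤n⇒m<n∨m≡n (Lex-≤ 3 x<y x≈y₃))
    where
    a = proj₂ (some-approximant ly cby)
    cba = approximant-rank-2 ly cby a
    x≈y₃ = agree3 (limit∈X lx) (limit∈X ly) e₄
    by-coef3 : coef x 3 < coef y 3 ⊎ coef x 3 ≡ coef y 3 → ⊥
    by-coef3 (inj₁ x₃<y₃) = forwardLow-excluded (limit∈X lx) (point∈X a) cbx cba z<s (s<s (s<s z<s))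
      (subst (coef x 3 <_) (sym (agree a 0)) x₃<y₃) (λ i → trans (x≈y₃ i) (sym (agree a (suc i)))) conn2
    by-coef3 (inj₂ x₃≡y₃) = forwardTop-excluded (limit∈X lx) (point∈X a) cbx cba z<s
      (≤-pred (subst (coef x 2 <_) (sym (pred-head a)) (<ₒ-head x y x<y cbx cby x≈y₂))) (λ i → trans (x≈y₂ i) (sym (agree a i))) conn6
      where x≈y₂ = agree-cons 2 x y x₃≡y₃ x≈y₃

  same-column-32 : ∀ {x y} → LimitPoint x → LimitPoint y → x <ₒ y → cb x ≡ 3 → cb y ≡ 2 → coef x 4 ≡ coef y 4 → ⊥
  same-column-32 lx ly x<y cbx cby e₄ =
    forwardTop-excluded (limit∈X lx) (limit∈X ly) cbx cby (s<s (s<s z<s)) (Lex-≤ 3 x<y x≈y₃) x≈y₃ conn4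
    where x≈y₃ = agree3 (limit∈X lx) (limit∈X ly) e₄

  same-column-33 : ∀ {x y} → LimitPoint x → LimitPoint y → x <ₒ y → cb x ≡ 3 → cb y ≡ 3 → coef x 4 ≡ coef y 4 → ⊥
  same-column-33 {x} {y} lx ly x<y cbx cby e₄ = by-rank (approximant-rank-3 ly cby a)
    where
    a = proj₂ (some-approximant ly cby)
    a′ = proj₂ (some-approximant lx cbx)
    x≈y₃ = agree3 (limit∈X lx) (limit∈X ly) e₄
    x₃<y₃ : coef x 3 < coef y 3
    x₃<y₃ = <ₒ-head x y x<y cbx cby x≈y₃
    by-rank′ : cb (point a) ≡ 0 → cb (point a′) ≡ 0 ⊎ cb (point a′) ≡ 2 → ⊥
    by-rank′ cba (inj₁ cba′) = backwardTop-excluded (limit∈X ly) (point∈X a′) cby cba′ z<s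
      (subst (_< coef y 3) (sym (pred-head a′)) x₃<y₃) (λ i → trans (sym (x≈y₃ i)) (sym (agree a′ i))) conn3
    by-rank′ cba (inj₂ cba′) = forwardLow-excluded (point∈X a′) (point∈X a) cba′ cba z<s (s<s (s<s z<s))
      (≤-pred (subst₂ _<_ (sym (pred-head a′)) (sym (pred-head a)) x₃<y₃))
      (λ i → trans (agree a′ i) (trans (x≈y₃ i) (sym (agree a i)))) conn2
    by-rank : cb (point a) ≡ 0 ⊎ cb (point a) ≡ 2 → ⊥
    by-rank (inj₁ cba) = by-rank′ cba (approximant-rank-3 lx cbx a′)
    by-rank (inj₂ cba) = forwardTop-excluded (limit∈X lx) (point∈X a) cbx cba (s<s (s<s z<s))
      (≤-pred (subst (coef x 3 <_) (sym (pred-head a)) x₃<y₃)) (λ i → trans (x≈y₃ i) (sym (agree a i))) conn4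

  same-column-23 : ∀ {x y} → LimitPoint x → LimitPoint y → x <ₒ y → cb x ≡ 2 → cb y ≡ 3 → coef x 4 ≡ coef y 4 → ⊥
  same-column-23 {x} {y} lx ly x<y cbx cby e₄ = by-gap (m≤n⇒m<n∨m≡n x₃<y₃)
    where
    a′ = proj₂ (some-approximant lx cbx)
    cba′ = approximant-rank-2 lx cbx a′
    x≈y₃ = agree3 (limit∈X lx) (limit∈X ly) e₄
    y₂≡0 : coef y 2 ≡ 0
    y₂≡0 = coef-<cb y 2 (subst (2 <_) (sym cby) (s<s (s<s z<s)))
    x₃<y₃ : coef x 3 < coef y 3
    x₃<y₃ = ≤∧≢⇒< (Lex-≤ 3 x<y x≈y₃) λ x₃≡y₃ →
      top≢0 lx cbx (n≤0⇒n≡0 (subst (coef x 2 ≤_) y₂≡0 (Lex-≤ 2 x<y (agree-cons 2 x y x₃≡y₃ x≈y₃))))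
    y≈a′₃ : AgreeAbove 3 y (point a′)
    y≈a′₃ i = trans (sym (x≈y₃ i)) (sym (agree a′ (suc i)))
    by-rank : ∀ (a : Approximant y 3 x) → suc (coef x 3) ≡ coef y 3 → cb (point a) ≡ 0 ⊎ cb (point a) ≡ 2 → ⊥
    by-rank a x₃+1≡y₃ rank = by-rank′ rank
      where
      x≈a₂ : AgreeAbove 2 x (point a)
      x≈a₂ = agree-cons 2 x (point a) (suc-injective (trans x₃+1≡y₃ (sym (pred-head a))))
        (λ i → trans (x≈y₃ i) (sym (agree a i)))
      by-rank′ : cb (point a) ≡ 0 ⊎ cb (point a) ≡ 2 → ⊥
      by-rank′ (inj₁ cba) = forwardTop-excluded (limit∈X lx) (point∈X a) cbx cba z<s (Lex-≤ 2 (above a) x≈a₂) x≈a₂ conn6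
      by-rank′ (inj₂ cba) = backwardTop-excluded (point∈X a) (point∈X a′) cba cba′ z<s
        (subst (_< coef (point a) 2) (sym (pred-head a′)) (<ₒ-head x (point a) (above a) cbx cba x≈a₂))
        (λ i → trans (sym (x≈a₂ i)) (sym (agree a′ i))) conn7
    by-gap : suc (coef x 3) < coef y 3 ⊎ suc (coef x 3) ≡ coef y 3 → ⊥
    by-gap (inj₁ gap) = backwardTop-excluded (limit∈X ly) (point∈X a′) cby cba′ z<s
      (subst (λ c → suc c < coef y 3) (sym (agree a′ 0)) gap) y≈a′₃ conn3
    by-gap (inj₂ x₃+1≡y₃) = by-rank a x₃+1≡y₃ (approximant-rank-3 ly cby a)
      where a = approach ly cby x≈y₃ x₃+1≡y₃

  rank3-not-below-rank4 : ∀ {x y} → LimitPoint x → LimitPoint y → cb x ≡ 3 → cb y ≡ 4 → suc (coef x 4) ≡ coef y 4 → ⊥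
  rank3-not-below-rank4 lx ly cbx cby e₄ =
    downward-excluded (limit∈X ly) (limit∈X lx) cby cbx (s<s (s<s (s<s z<s))) (sym e₄) (agree4 (limit∈X ly) (limit∈X lx)) conn11

  same-column : ∀ {x y} → LimitPoint x → LimitPoint y → x <ₒ y → Low x → Low y → coef x 4 ≡ coef y 4 → ⊥
  same-column lx ly x<y (inj₁ cbx) (inj₁ cby) = same-column-22 lx ly x<y cbx cby
  same-column lx ly x<y (inj₁ cbx) (inj₂ cby) = same-column-23 lx ly x<y cbx cby
  same-column lx ly x<y (inj₂ cbx) (inj₁ cby) = same-column-32 lx ly x<y cbx cby
  same-column lx ly x<y (inj₂ cbx) (inj₂ cby) = same-column-33 lx ly x<y cbx cby

  rank2-below-rank4 : ∀ {x y} → LimitPoint x → cb x ≡ 2 → LimitPoint y → cb y ≡ 4 → coef y 4 ≡ suc (coef x 4)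
  rank2-below-rank4 {x} {y} lx cbx ly cby = by-cmp (<-cmp (coef y 4) (suc (coef (point a) 4)))
    where
    a = proj₂ (some-approximant lx cbx)
    cba = approximant-rank-2 lx cbx a
    y≈a₄ = agree4 (limit∈X ly) (point∈X a)
    by-cmp : Tri (coef y 4 < suc (coef (point a) 4)) (coef y 4 ≡ suc (coef (point a) 4)) (suc (coef (point a) 4) < coef y 4) →
      coef y 4 ≡ suc (coef x 4)
    by-cmp (tri< lt _ _) = ⊥-elim (forwardTop-excluded (limit∈X ly) (point∈X a) cby cba z<s (≤-pred lt) y≈a₄ conn9)
    by-cmp (tri≈ _ eq _) = trans eq (cong suc (agree a 1))
    by-cmp (tri> _ _ gt) = ⊥-elim (backwardTop-excluded (limit∈X ly) (point∈X a) cby cba z<s gt y≈a₄ conn10)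

  weight : Ord → ℕ
  weight x = if cb x ≡ᵇ 4 then coef x 4 else suc (coef x 4)

  weight-4 : ∀ x → cb x ≡ 4 → weight x ≡ coef x 4
  weight-4 x cbx rewrite cbx = refl

  weight-low : ∀ x → Low x → weight x ≡ suc (coef x 4)
  weight-low x (inj₁ cbx) rewrite cbx = refl
  weight-low x (inj₂ cbx) rewrite cbx = refl

  weight-mono : ∀ {x y} → LimitPoint x → LimitPoint y → x <ₒ y → weight x ≤ weight y
  weight-mono {x} {y} lx ly x<y with rank-of-limit lx | rank-of-limit ly
  ... | inj₁ lowx | inj₁ lowy = subst₂ _≤_ (sym (weight-low x lowx)) (sym (weight-low y lowy)) (s≤s x₄≤y₄)
    where x₄≤y₄ = coef4-≤ (limit∈X lx) (limit∈X ly) x<y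
  ... | inj₁ lowx | inj₂ cby  = subst₂ _≤_ (sym (weight-low x lowx)) (sym (weight-4 y cby))
                                  (coef4-< (limit∈X lx) (limit∈X ly) x<y cby)
  ... | inj₂ cbx  | inj₁ lowy = subst₂ _≤_ (sym (weight-4 x cbx)) (sym (weight-low y lowy)) (m≤n⇒m≤1+n x₄≤y₄)
    where x₄≤y₄ = coef4-≤ (limit∈X lx) (limit∈X ly) x<y
  ... | inj₂ cbx  | inj₂ cby  = subst₂ _≤_ (sym (weight-4 x cbx)) (sym (weight-4 y cby)) (coef4-≤ (limit∈X lx) (limit∈X ly) x<y)

  equal-weights : ∀ {x y} → LimitPoint x → LimitPoint y → x <ₒ y → weight x ≡ weight y → cb x ≡ 2 × cb y ≡ 4
  equal-weights {x} {y} lx ly x<y w with rank-of-limit lx | rank-of-limit ly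
  ... | inj₁ lowx       | inj₁ lowy = ⊥-elim (same-column lx ly x<y lowx lowy
                                        (suc-injective (trans (sym (weight-low x lowx)) (trans w (weight-low y lowy)))))
  ... | inj₁ (inj₁ cbx) | inj₂ cby  = cbx , cby
  ... | inj₁ (inj₂ cbx) | inj₂ cby  = ⊥-elim (rank3-not-below-rank4 lx ly cbx cby
                                        (trans (sym (weight-low x (inj₂ cbx))) (trans w (weight-4 y cby))))
  ... | inj₂ cbx        | inj₁ lowy = ⊥-elim (1+n≰n (subst (_≤ coef y 4) (trans (sym (weight-4 x cbx)) (trans w (weight-low y lowy)))
                                        (coef4-≤ (limit∈X lx) (limit∈X ly) x<y)))
  ... | inj₂ cbx        | inj₂ cby  = ⊥-elim (<-irrefl (trans (sym (weight-4 x cbx)) (trans w (weight-4 y cby)))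
                                        (coef4-< (limit∈X lx) (limit∈X ly) x<y cby))

  weight-positive : ∀ {x} → LimitPoint x → 1 ≤ weight x
  weight-positive {x} lx with rank-of-limit lx
  ... | inj₁ lowx = subst (1 ≤_) (sym (weight-low x lowx)) (s≤s z≤n)
  ... | inj₂ cbx  = subst (1 ≤_) (sym (weight-4 x cbx)) (n≢0⇒n>0 (top≢0 lx cbx))

  coef4-bounded : ∀ {x} → X x → coef x 4 ≤ suc (n ∸ 3)
  coef4-bounded {x} Xx = Lex-≤ 4 (X<γ x Xx) (vanish5 Xx)

  weight-bounded : ∀ {x} → LimitPoint x → weight x ≤ suc (n ∸ 3)
  weight-bounded {x} lx with rank-of-limit lx
  ... | inj₂ cbx  = subst (_≤ suc (n ∸ 3)) (sym (weight-4 x cbx)) (coef4-bounded (limit∈X lx))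
  ... | inj₁ lowx = subst (_≤ suc (n ∸ 3)) (sym (weight-low x lowx)) (≤∧≢⇒< (coef4-bounded (limit∈X lx)) x₄≢γ₄)
    where
    x<γ = X<γ x (limit∈X lx)
    x₄≢γ₄ : coef x 4 ≢ suc (n ∸ 3)
    x₄≢γ₄ e₄ = by-rank lowx
      where
      x≈γ₃ = agree-cons 3 x (gammaOf n) e₄ (vanish5 (limit∈X lx))
      x₃≡0 = n≤0⇒n≡0 (Lex-≤ 3 x<γ x≈γ₃)
      x₂≡0 = n≤0⇒n≡0 (Lex-≤ 2 x<γ (agree-cons 2 x (gammaOf n) x₃≡0 x≈γ₃))
      by-rank : Low x → ⊥
      by-rank (inj₁ cbx) = top≢0 lx cbx x₂≡0
      by-rank (inj₂ cbx) = top≢0 lx cbx x₃≡0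

  chain-bound : (x : ℕ → Ord) (N : ℕ) → (∀ i → i ≤ N → LimitPoint (x i)) →
    (∀ i j → i < j → j ≤ N → x i <ₒ x j) → N ≤ suc (n ∸ 3)
  chain-bound x N limit increasing = ≤-pred (begin
    suc N                    ≤⟨ +-monoˡ-≤ N (weight-positive (limit 0 z≤n)) ⟩
    b 0 + N                  ≤⟨ growth-with-one-flat-step b N mono one-flat ⟩
    suc (b N)                ≤⟨ s≤s (weight-bounded (limit N ≤-refl)) ⟩
    suc (suc (n ∸ 3))        ∎)
    where
    open ≤-Reasoning
    b : ℕ → ℕ
    b i = weight (x i)
    step : ∀ i → i < N → x i <ₒ x (suc i)
    step i i<N = increasing i (suc i) (n<1+n i) i<N
    mono : ∀ i → i < N → b i ≤ b (suc i)
    mono i i<N = weight-mono (limit i (<⇒≤ i<N)) (limit (suc i) i<N) (step i i<N)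
    -- The upper ends of two flat steps would have equal weights, so the first would have rank 2.
    one-flat : ∀ i j → i < j → j < N → b i ≡ b (suc i) → b j ≡ b (suc j) → ⊥
    one-flat i j i<j j<N flat-i flat-j = 2≢4 (trans (sym (proj₁ later)) (proj₂ first))
      where
      i<N = <-trans i<j j<N
      first = equal-weights (limit i (<⇒≤ i<N)) (limit (suc i) i<N) (step i i<N) flat-i
      second = equal-weights (limit j (<⇒≤ j<N)) (limit (suc j) j<N) (step j j<N) flat-j
      column : b (suc i) ≡ b (suc j)
      column = begin-equality
        b (suc i)                    ≡⟨ sym flat-i ⟩
        b i                          ≡⟨ weight-low (x i) (inj₁ (proj₁ first)) ⟩
        suc (coef (x i) 4)           ≡⟨ sym (rank2-below-rank4 (limit i (<⇒≤ i<N)) (proj₁ first) (limit (suc j) j<N) (proj₂ second)) ⟩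
        coef (x (suc j)) 4           ≡⟨ sym (weight-4 (x (suc j)) (proj₂ second)) ⟩
        b (suc j)                    ∎
      later = equal-weights (limit (suc i) i<N) (limit (suc j) j<N) (increasing (suc i) (suc j) (s<s i<j) j<N) column
      2≢4 : 2 ≢ 4
      2≢4 ()

-- No colour-0 closed copy of ω·n + 1

ω·suc : ℕ → Ord
ω·suc j = cnf 1 j (0 ∷ [])

ω·suc-< : ∀ {i j} → i < j → ω·suc i <ₒ ω·suc j
ω·suc-< i<j = Lex-at 1 (s<s i<j) (λ _ → refl)

zer<ω·suc : ∀ j → zer <ₒ ω·suc j
zer<ω·suc j = Lex-at 1 z<s (λ _ → refl)

ω·suc<ω·suc+1 : ∀ {j N} → j ≤ N → ω·suc j <ₒ cnf 1 N (1 ∷ [])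
ω·suc<ω·suc+1 j≤N with m≤n⇒m<n∨m≡n j≤N
... | inj₁ j<N  = Lex-at 1 (s<s j<N) (λ _ → refl)
... | inj₂ refl = Lex-at 0 z<s λ { zero → refl ; (suc i) → refl }

n∸1≰1+n∸3 : ∀ {n} → 4 ≤ n → ¬ (n ∸ 1 ≤ suc (n ∸ 3))
n∸1≰1+n∸3 (s≤s (s≤s (s≤s (s≤s _)))) le = 1+n≰n (≤-pred le)

no-homogeneous-copy : ∀ n → 4 ≤ n → ¬ (Σ (Ord → Set) λ X → ClosedCopy (gammaOf n) X (omegaNPlus1 n) ×
  (∀ x y → X x → X y → x <ₒ y → ¬ Red (gammaOf n) x y))
no-homogeneous-copy n 4≤n (X , (X<γ , f , f<β , f-onto , f-iso , _ , f-open) , colour0) =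
  n∸1≰1+n∸3 4≤n (chain-bound x N limit increasing)
  where
  open Colour0 n X X<γ colour0
  N = n ∸ 1
  f-reflects : ∀ x y → X x → X y → f x <ₒ f y → x <ₒ y
  f-reflects x y Xx Xy = proj₂ (f-iso x y Xx Xy)
  -- x i is the preimage of ω·(1 + i); clamping i to N makes x total.
  preimage : ∀ i → Σ Ord λ x → X x × (f x ≡ ω·suc (i ⊓ N))
  preimage i = f-onto (ω·suc (i ⊓ N)) (ω·suc<ω·suc+1 (m⊓n≤n i N))
  x : ℕ → Ord
  x i = proj₁ (preimage i)
  X-x : ∀ i → X (x i)
  X-x i = proj₁ (proj₂ (preimage i))
  fx : ∀ i → i ≤ N → f (x i) ≡ ω·suc i
  fx i i≤N = trans (proj₂ (proj₂ (preimage i))) (cong ω·suc (m≤n⇒m⊓n≡m i≤N))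
  increasing : ∀ i j → i < j → j ≤ N → x i <ₒ x j
  increasing i j i<j j≤N = f-reflects (x i) (x j) (X-x i) (X-x j)
    (subst₂ _<ₒ_ (sym (fx i (<⇒≤ (<-≤-trans i<j j≤N)))) (sym (fx j j≤N)) (ω·suc-< i<j))
  zero-preimage : Σ Ord λ w → X w × (f w ≡ zer)
  zero-preimage = f-onto zer (Lex-trans (zer<ω·suc 0) (ω·suc<ω·suc+1 z≤n))
  limit : ∀ i → i ≤ N → LimitPoint (x i)
  limit i i≤N = record
    { limit∈X    = X-x i
    ; nonzero    = λ x≡0 → ¬<ₒzer w (subst (w <ₒ_) x≡0 w<x)
    ; approached = approached-from-below f<β f-reflects f-open (X-x i)
                     (subst (zer <ₒ_) (sym (fx i i≤N)) (zer<ω·suc i)) (cong (λ α → coef α 0) (fx i i≤N))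
    }
    where
    w = proj₁ zero-preimage
    w<x : w <ₒ x i
    w<x = f-reflects w (x i) (proj₁ (proj₂ zero-preimage)) (X-x i)
      (subst₂ _<ₒ_ (sym (proj₂ (proj₂ zero-preimage))) (sym (fx i i≤N)) (zer<ω·suc i))

proposition4p2 : (n : ℕ) → 4 ≤ n →
    (¬ (Σ Ord λ a → Σ Ord λ b → Σ Ord λ c →
          (a <ₒ b) × (b <ₒ c) × (c <ₒ gammaOf n) ×
          Red (gammaOf n) a b × Red (gammaOf n) a c × Red (gammaOf n) b c))
    × (¬ (Σ (Ord → Set) λ X → ClosedCopy (gammaOf n) X (omegaNPlus1 n) ×
          (∀ x y → X x → X y → x <ₒ y → ¬ Red (gammaOf n) x y)))
proposition4p2 n 4≤n = no-red-triangle (gammaOf n) , no-homogeneous-copy n 4≤n
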